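{- $\mathbb P(3,3) = \frac{1}{4}$, and this value is attained by the complete graph $K_2$: for three independent uniformly random vertices of $K_2$, the probability that they form an independent set is $\frac14$.
   Context: All graphs are finite simple graphs with at least one vertex. For integers $s \geq 1$ and $t \geq 2$, $\mathbb P(s,t)$ is the infimum, over all graphs $G$ containing no clique on $t$ vertices, of the probability that, when $v_1,\dots,v_s$ are vertices of $G$ chosen independently and uniformly at random (repetitions allowed), the set $\{v_1,\dots,v_s\}$ is an independent set of $G$. -}

module Defs where

open import Data.Nat using (ℕ; zero; suc; _+_; _^_; NonZero)
open import Data.Nat.Properties using (m^n≢0)
open import Data.Bool using (Bool; true; false; _∧_; not)
open import Data.Fin using (Fin)
open import Data.Vec using (Vec; []; _∷_)
open import Data.List using (List; []; _∷_; concatMap; map; length; filter; allFin)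
open import Data.Product using (Σ; _×_; _,_; ∃-syntax)
open import Function.Definitions using (Injective)
open import Relation.Binary.PropositionalEquality using (_≡_)
open import Relation.Nullary using (¬_)
open import Data.Bool.Properties using (T?)
open import Data.Bool using (T)
open import Data.Integer using (+_)
open import Data.Rational using (ℚ; _/_; _≤_)

record Graph : Set where
  field
    m     : ℕ
    adj   : Fin (suc m) → Fin (suc m) → Bool
    sym   : ∀ x y → adj x y ≡ adj y x
    irref : ∀ x → adj x x ≡ false

open Graph public

V : Graph → ℕ
V G = suc (m G)

HasClique : ℕ → Graph → Set
HasClique t G = Σ (Fin t → Fin (V G)) λ f →
  Injective _≡_ _≡_ f × (∀ i j → ¬ (i ≡ j) → adj G (f i) (f j) ≡ true)

tuples : (n s : ℕ) → List (Vec (Fin n) s)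
tuples n zero = [] ∷ []
tuples n (suc s) = concatMap (λ v → map (v ∷_) (tuples n s)) (allFin n)

nonAdjAll : (G : Graph) → Fin (V G) → ∀ {k} → Vec (Fin (V G)) k → Bool
nonAdjAll G x [] = true
nonAdjAll G x (y ∷ ys) = not (adj G x y) ∧ nonAdjAll G x ys

isIndep : (G : Graph) → ∀ {k} → Vec (Fin (V G)) k → Bool
isIndep G [] = true
isIndep G (x ∷ xs) = nonAdjAll G x xs ∧ isIndep G xs

indepCount : ℕ → Graph → ℕ
indepCount s G = length (filter (λ v → T? (isIndep G v)) (tuples (V G) s))

indepProb : ℕ → Graph → ℚ
indepProb s G = (+ indepCount s G) / (V G ^ s)
  where instance _ = m^n≢0 (V G) s

IsInfP : ℕ → ℕ → ℚ → Set
IsInfP s t q =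
  (∀ G → ¬ HasClique t G → q ≤ indepProb s G) ×
  (∀ r → (∀ G → ¬ HasClique t G → r ≤ indepProb s G) → r ≤ q)

K2adj : Fin 2 → Fin 2 → Bool
K2adj Fin.zero Fin.zero = false
K2adj Fin.zero (Fin.suc Fin.zero) = true
K2adj (Fin.suc Fin.zero) Fin.zero = true
K2adj (Fin.suc Fin.zero) (Fin.suc Fin.zero) = false

K2 : Graph
K2 = record { m = 1 ; adj = K2adj ; sym = s ; irref = i }
  where
  s : ∀ x y → K2adj x y ≡ K2adj y x
  s Fin.zero Fin.zero = _≡_.refl
  s Fin.zero (Fin.suc Fin.zero) = _≡_.refl
  s (Fin.suc Fin.zero) Fin.zero = _≡_.refl
  s (Fin.suc Fin.zero) (Fin.suc Fin.zero) = _≡_.refl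
  i : ∀ x → K2adj x x ≡ false
  i Fin.zero = _≡_.refl
  i (Fin.suc Fin.zero) = _≡_.refl

{-# OPTIONS --safe #-}
module Submission where

-- Let σ x y be −1 if x ~ y and +1 otherwise. For vertices x, y, z of a
-- triangle-free graph, 4·[{x,y,z} independent] = 1 + σxy·σxz + σyx·σyz + σzx·σzy:
-- checking the edge patterns with no edge, one edge and a path gives 4, 0, 0 (only
-- a triangle would break it). Summed over all n³ triples, each product term becomes
-- Σₓ (Σ_y σ x y)² ≥ 0, hence 4·#{independent triples} ≥ n³, i.e. the probability is
-- at least 1/4. The triangle-free graph K₂ has exactly 2 of its 8 triples independent.

open import Defs
open import Data.Product using (_×_; _,_; proj₁; proj₂)
open import Relation.Nullary using (¬_; yes; no; contradiction)
open import Relation.Binary.PropositionalEquality as ≡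
  using (_≡_; _≢_; refl; trans; cong; cong₂; subst; subst₂; module ≡-Reasoning)
open import Data.Bool using (Bool; true; false)
open import Data.Bool.Properties using (T?)
open import Data.Fin using (Fin; zero; suc; _≟_)
open import Data.Fin.Patterns using (0F; 1F; 2F)
open import Data.Fin.Properties using (pigeonhole; <⇒≢)
open import Data.Integer as ℤ using (ℤ; +_; -[1+_]; _+_; _*_; _≤_; +≤+)
import Data.Integer.Properties as ℤ
open import Data.List using (List; []; _∷_; _++_; map; concatMap; length; filter; tabulate)
open import Data.List.Properties using (filter-++; length-++)
open import Data.Nat as ℕ using (ℕ; zero; suc; z≤n)
import Data.Nat.Properties as ℕ
open import Data.Rational as ℚ using (_/_)
import Data.Rational.Properties as ℚ
import Data.Rational.Unnormalised as ℚᵘ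
import Data.Rational.Unnormalised.Properties as ℚᵘ
open import Data.Vec using (Vec; []; _∷_)
open import Function using (_∘_)

open import Algebra.Properties.Semiring.Sum ℤ.+-*-semiring

∑∑-* : ∀ {m k} (f : Fin m → ℤ) (g : Fin k → ℤ) →
  ∑[ i < m ] ∑[ j < k ] (f i * g j) ≡ sum f * sum g
∑∑-* f g = ≡.sym (trans (*-distribʳ-sum (sum g) f)
  (sum-cong-≗ λ i → *-distribˡ-sum (f i) g))

∑-const : ∀ n m → ∑[ i < n ] (+ m) ≡ + (n ℕ.* m)
∑-const zero    m = refl
∑-const (suc n) m = trans (cong (_+_ (+ m)) (∑-const n m)) (≡.sym (ℤ.pos-+ m (n ℕ.* m)))

∑-nonNeg : ∀ {n} (f : Fin n → ℤ) → (∀ i → + 0 ≤ f i) → + 0 ≤ sum f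
∑-nonNeg {zero}  f 0≤f = +≤+ z≤n
∑-nonNeg {suc n} f 0≤f = ℤ.+-mono-≤ (0≤f zero) (∑-nonNeg (f ∘ suc) (0≤f ∘ suc))

0≤i*i : ∀ i → + 0 ≤ i * i
0≤i*i (+ k)     = subst (+ 0 ≤_) (ℤ.pos-* k k) (+≤+ z≤n)
0≤i*i -[1+ k ] = +≤+ z≤n

∑³ : ∀ {n} → (Fin n → Fin n → Fin n → ℤ) → ℤ
∑³ {n} f = ∑[ x < n ] ∑[ y < n ] ∑[ z < n ] f x y z

module _ {n : ℕ} where

  ∑³-cong : {f g : Fin n → Fin n → Fin n → ℤ} → (∀ x y z → f x y z ≡ g x y z) → ∑³ f ≡ ∑³ g
  ∑³-cong f≗g = sum-cong-≗ λ x → sum-cong-≗ λ y → sum-cong-≗ λ z → f≗g x y z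

  ∑³-distrib-+ : (f g : Fin n → Fin n → Fin n → ℤ) →
    ∑³ (λ x y z → f x y z + g x y z) ≡ ∑³ f + ∑³ g
  ∑³-distrib-+ f g = trans
    (sum-cong-≗ λ x → trans (sum-cong-≗ λ y → ∑-distrib-+ (f x y) (g x y))
                             (∑-distrib-+ (λ y → sum (f x y)) (λ y → sum (g x y))))
    (∑-distrib-+ (λ x → ∑[ y < n ] sum (f x y)) (λ x → ∑[ y < n ] sum (g x y)))

  ∑³-*ˡ : ∀ c (f : Fin n → Fin n → Fin n → ℤ) → ∑³ (λ x y z → c * f x y z) ≡ c * ∑³ f
  ∑³-*ˡ c f = ≡.sym (trans (*-distribˡ-sum c (λ x → ∑[ y < n ] sum (f x y)))
    (sum-cong-≗ λ x → trans (*-distribˡ-sum c (λ y → sum (f x y)))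
                            (sum-cong-≗ λ y → *-distribˡ-sum c (f x y))))

  ∑³-swap₁₂ : (f : Fin n → Fin n → Fin n → ℤ) → ∑³ f ≡ ∑³ (λ x y z → f y x z)
  ∑³-swap₁₂ f = ∑-comm (λ x y → ∑[ z < n ] f x y z)

  ∑³-swap₂₃ : (f : Fin n → Fin n → Fin n → ℤ) → ∑³ f ≡ ∑³ (λ x y z → f x z y)
  ∑³-swap₂₃ f = sum-cong-≗ λ x → ∑-comm (f x)

  ∑³-const-1 : ∑³ {n} (λ _ _ _ → + 1) ≡ + (n ℕ.^ 3)
  ∑³-const-1 = trans (sum-cong-≗ {n} λ x → trans (sum-cong-≗ {n} λ y → ∑-const n 1) (∑-const n (n ℕ.* 1)))
                     (∑-const n (n ℕ.* (n ℕ.* 1)))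

  ∑³-rowProducts : (M : Fin n → Fin n → ℤ) →
    ∑³ (λ x y z → M x y * M x z) ≡ ∑[ x < n ] (sum (M x) * sum (M x))
  ∑³-rowProducts M = sum-cong-≗ λ x → ∑∑-* (M x) (M x)

count : {A : Set} → (A → Bool) → List A → ℕ
count P xs = length (filter (T? ∘ P) xs)

count-map : ∀ {A B : Set} (P : B → Bool) (f : A → B) xs → count P (map f xs) ≡ count (P ∘ f) xs
count-map P f []       = refl
count-map P f (x ∷ xs) with P (f x)
... | true  = cong suc (count-map P f xs)
... | false = count-map P f xs

module _ {A : Set} (P : A → Bool) where

  count-++ : ∀ xs ys → count P (xs ++ ys) ≡ count P xs ℕ.+ count P ys
  count-++ xs ys = trans (cong length (filter-++ (T? ∘ P) xs ys)) (length-++ (filter (T? ∘ P) xs))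

  count-concatMap-tabulate : ∀ {B : Set} {k} (f : B → List A) (g : Fin k → B) →
    + count P (concatMap f (tabulate g)) ≡ ∑[ i < k ] (+ count P (f (g i)))
  count-concatMap-tabulate {k = zero}  f g = refl
  count-concatMap-tabulate {k = suc k} f g = begin
    + count P (f (g zero) ++ rest)
      ≡⟨ cong +_ (count-++ (f (g zero)) rest) ⟩
    + (count P (f (g zero)) ℕ.+ count P rest)
      ≡⟨ ℤ.pos-+ (count P (f (g zero))) (count P rest) ⟩
    + count P (f (g zero)) + + count P rest
      ≡⟨ cong (_+_ (+ count P (f (g zero)))) (count-concatMap-tabulate f (g ∘ suc)) ⟩
    ∑[ i < suc k ] (+ count P (f (g i))) ∎
    where
    open ≡-Reasoning
    rest = concatMap f (tabulate (g ∘ suc))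

ind : Bool → ℤ
ind true  = + 1
ind false = + 0

sumTuples : ∀ {n} s → (Vec (Fin n) s → ℤ) → ℤ
sumTuples zero        f = f []
sumTuples {n} (suc s) f = ∑[ x < n ] sumTuples s (λ v → f (x ∷ v))

count-tuples : ∀ {n} s (P : Vec (Fin n) s → Bool) → + count P (tuples n s) ≡ sumTuples s (ind ∘ P)
count-tuples zero P with P []
... | true  = refl
... | false = refl
count-tuples {n} (suc s) P =
  trans (count-concatMap-tabulate P (λ x → map (x ∷_) (tuples n s)) (λ x → x))
        (sum-cong-≗ {n} λ x → trans (cong +_ (count-map P (x ∷_) (tuples n s)))
                                    (count-tuples s (λ v → P (x ∷ v))))

sign : Bool → ℤ
sign true  = ℤ.-1ℤ
sign false = + 1

module _ (G : Graph) where

  adjacent⇒≢ : ∀ {x y} → adj G x y ≡ true → x ≢ y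
  adjacent⇒≢ {x} x~y refl with trans (≡.sym (irref G x)) x~y
  ... | ()

  pairwiseAdjacent⇒HasClique : ∀ {t} (f : Fin t → Fin (V G)) →
    (∀ i j → i ≢ j → adj G (f i) (f j) ≡ true) → HasClique t G
  pairwiseAdjacent⇒HasClique f adjacent = f , injective , adjacent
    where
    injective : ∀ {i j} → f i ≡ f j → i ≡ j
    injective {i} {j} fi≡fj with i ≟ j
    ... | yes i≡j = i≡j
    ... | no  i≢j = contradiction fi≡fj (adjacent⇒≢ (adjacent i j i≢j))

  HasClique⇒≤V : ∀ {t} → HasClique t G → t ℕ.≤ V G
  HasClique⇒≤V {t} (f , injective , _) with t ℕ.≤? V G
  ... | yes t≤V = t≤V
  ... | no  t≰V with pigeonhole (ℕ.≰⇒> t≰V) f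
  ...   | i , j , i<j , fi≡fj = contradiction (injective fi≡fj) (<⇒≢ i<j)

  triangle⇒HasClique : ∀ {x y z} → adj G x y ≡ true → adj G x z ≡ true → adj G y z ≡ true →
    HasClique 3 G
  triangle⇒HasClique {x} {y} {z} x~y x~z y~z = pairwiseAdjacent⇒HasClique corner adjacent
    where
    corner : Fin 3 → Fin (V G)
    corner 0F = x
    corner 1F = y
    corner 2F = z
    adjacent : ∀ i j → i ≢ j → adj G (corner i) (corner j) ≡ true
    adjacent 0F 0F i≢i = contradiction refl i≢i
    adjacent 0F 1F _   = x~y
    adjacent 0F 2F _   = x~z
    adjacent 1F 0F _   = trans (sym G y x) x~y
    adjacent 1F 1F i≢i = contradiction refl i≢i
    adjacent 1F 2F _   = y~z
    adjacent 2F 0F _   = trans (sym G z x) x~z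
    adjacent 2F 1F _   = trans (sym G z y) y~z
    adjacent 2F 2F i≢i = contradiction refl i≢i

  σ : Fin (V G) → Fin (V G) → ℤ
  σ x y = sign (adj G x y)

  four-ind-isIndep : ¬ HasClique 3 G → ∀ x y z →
    + 4 * ind (isIndep G (x ∷ y ∷ z ∷ [])) ≡ + 1 + σ x y * σ x z + σ y x * σ y z + σ z x * σ z y
  four-ind-isIndep K₃-free x y z
    rewrite sym G y x | sym G z x | sym G z y
    with adj G x y in x~y | adj G x z in x~z | adj G y z in y~z
  ... | true  | true  | true  = contradiction (triangle⇒HasClique x~y x~z y~z) K₃-free
  ... | true  | true  | false = refl
  ... | true  | false | true  = refl
  ... | true  | false | false = refl
  ... | false | true  | true  = refl
  ... | false | true  | false = refl
  ... | false | false | true  = refl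
  ... | false | false | false = refl

  ∑rowSum² : ℤ
  ∑rowSum² = ∑[ x < V G ] (sum (σ x) * sum (σ x))

  four-indepCount : ¬ HasClique 3 G →
    + 4 * + indepCount 3 G ≡ + (V G ℕ.^ 3) + ∑rowSum² + ∑rowSum² + ∑rowSum²
  four-indepCount K₃-free = begin
    + 4 * + indepCount 3 G
      ≡⟨ cong (+ 4 *_) (count-tuples 3 (isIndep G)) ⟩
    + 4 * ∑³ (λ x y z → ind (isIndep G (x ∷ y ∷ z ∷ [])))
      ≡⟨ ≡.sym (∑³-*ˡ (+ 4) (λ x y z → ind (isIndep G (x ∷ y ∷ z ∷ [])))) ⟩
    ∑³ (λ x y z → + 4 * ind (isIndep G (x ∷ y ∷ z ∷ [])))
      ≡⟨ ∑³-cong (four-ind-isIndep K₃-free) ⟩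
    ∑³ (λ x y z → + 1 + A x y z + B x y z + C x y z)
      ≡⟨ ∑³-distrib-+ (λ x y z → + 1 + A x y z + B x y z) C ⟩
    ∑³ (λ x y z → + 1 + A x y z + B x y z) + ∑³ C
      ≡⟨ cong (_+ ∑³ C) (∑³-distrib-+ (λ x y z → + 1 + A x y z) B) ⟩
    ∑³ (λ x y z → + 1 + A x y z) + ∑³ B + ∑³ C
      ≡⟨ cong (λ t → t + ∑³ B + ∑³ C) (∑³-distrib-+ {V G} (λ _ _ _ → + 1) A) ⟩
    ∑³ {V G} (λ _ _ _ → + 1) + ∑³ A + ∑³ B + ∑³ C
      ≡⟨ cong₂ _+_ (cong₂ _+_ (cong₂ _+_ (∑³-const-1 {V G}) ∑³A) ∑³B) ∑³C ⟩
    + (V G ℕ.^ 3) + ∑rowSum² + ∑rowSum² + ∑rowSum² ∎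
    where
    open ≡-Reasoning
    A B C : Fin (V G) → Fin (V G) → Fin (V G) → ℤ
    A x y z = σ x y * σ x z
    B x y z = σ y x * σ y z
    C x y z = σ z x * σ z y
    ∑³A : ∑³ A ≡ ∑rowSum²
    ∑³A = ∑³-rowProducts σ
    ∑³B : ∑³ B ≡ ∑rowSum²
    ∑³B = trans (∑³-swap₁₂ B) ∑³A
    ∑³C : ∑³ C ≡ ∑rowSum²
    ∑³C = trans (∑³-swap₂₃ C) ∑³B

  indepCount-lowerBound : ¬ HasClique 3 G → + (V G ℕ.^ 3) ≤ + 4 * + indepCount 3 G
  indepCount-lowerBound K₃-free = begin
    + (V G ℕ.^ 3)                                   ≤⟨ ≤+∑rowSum² _ ⟩
    + (V G ℕ.^ 3) + ∑rowSum²                        ≤⟨ ≤+∑rowSum² _ ⟩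
    + (V G ℕ.^ 3) + ∑rowSum² + ∑rowSum²             ≤⟨ ≤+∑rowSum² _ ⟩
    + (V G ℕ.^ 3) + ∑rowSum² + ∑rowSum² + ∑rowSum²  ≡⟨ ≡.sym (four-indepCount K₃-free) ⟩
    + 4 * + indepCount 3 G                          ∎
    where
    open ℤ.≤-Reasoning
    ≤+∑rowSum² : ∀ i → i ≤ i + ∑rowSum²
    ≤+∑rowSum² i = ℤ.i≤i+j i ∑rowSum² {{ℤ.nonNegative (∑-nonNeg _ λ x → 0≤i*i (sum (σ x)))}}

*≤*⇒/≤/ : ∀ i j d e .{{_ : ℕ.NonZero d}} .{{_ : ℕ.NonZero e}} →
  i * + e ≤ j * + d → i / d ℚ.≤ j / e
*≤*⇒/≤/ i j (suc k) (suc l) ie≤jd = ℚ.toℚᵘ-cancel-≤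
  (ℚᵘ.≤-resp₂-≃ .proj₁ (ℚᵘ.≃-sym (ℚ.toℚᵘ-fromℚᵘ (ℚᵘ.mkℚᵘ j l)))
    (ℚᵘ.≤-resp₂-≃ .proj₂ (ℚᵘ.≃-sym (ℚ.toℚᵘ-fromℚᵘ (ℚᵘ.mkℚᵘ i k))) (ℚᵘ.*≤* ie≤jd)))

indepProb-lowerBound : ∀ G → ¬ HasClique 3 G → (+ 1) / 4 ℚ.≤ indepProb 3 G
indepProb-lowerBound G K₃-free =
  *≤*⇒/≤/ (+ 1) (+ indepCount 3 G) 4 (V G ℕ.^ 3) {{_}} {{ℕ.m^n≢0 (V G) 3}}
    (subst₂ _≤_ (≡.sym (ℤ.*-identityˡ _)) (ℤ.*-comm (+ 4) (+ indepCount 3 G))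
      (indepCount-lowerBound G K₃-free))

K₂-K₃-free : ¬ HasClique 3 K2
K₂-K₃-free K₃ = ℕ.<⇒≱ (ℕ.n<1+n 2) (HasClique⇒≤V K2 K₃)

mainTheorem10 : IsInfP 3 3 ((+ 1) / 4) × ¬ HasClique 3 K2 × indepProb 3 K2 ≡ (+ 1) / 4
mainTheorem10 =
  (indepProb-lowerBound , λ r r≤indepProb → r≤indepProb K2 K₂-K₃-free) , K₂-K₃-free , refl
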